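{- Let $c$ be a $3$-coloring of the nonzero rational numbers without a monochromatic solution to $x_0+\tfrac{3}{2}x_1=\tfrac{9}{4}x_2$, and let $x$ be a nonzero rational number such that $c(2x)=c(x)$. Then for all integers $m_1,n_1,p_1,m_2,n_2,p_2$ we have $c(2^{n_1}3^{m_1}5^{p_1}x)=c(2^{n_2}3^{m_2}5^{p_2}x)$ if and only if $m_1\equiv m_2\pmod 3$.
   Context: A solution is a triple of nonzero rationals (not necessarily distinct) satisfying the equation; it is monochromatic if all entries have the same color. -}

module Defs where

open import Data.Nat as ℕ using (ℕ; suc)
open import Data.Nat.Properties using (m^n≢0)
open import Data.Integer as ℤ using (ℤ; +_; -[1+_])
open import Data.Rational using (ℚ; 0ℚ; _+_; _*_; _/_; 1/_)
open import Data.Fin using (Fin)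
open import Data.Product using (Σ; _×_; ∃; _,_; proj₁)
open import Relation.Binary.PropositionalEquality using (_≡_; _≢_)
open import Relation.Nullary using (¬_)

-- a 3-colouring of the nonzero rationals, represented as a map on all of ℚ
-- whose value at 0 is never used
Colouring3 : Set
Colouring3 = ℚ → Fin 3

IsSolution : ℚ → ℚ → ℚ → Set
IsSolution x₀ x₁ x₂ = x₀ + ((+ 3) / 2) * x₁ ≡ ((+ 9) / 4) * x₂

MonoSolution : Colouring3 → Set
MonoSolution c = Σ ℚ λ a → Σ ℚ λ b → Σ ℚ λ d →
  a ≢ 0ℚ × b ≢ 0ℚ × d ≢ 0ℚ × IsSolution a b d × c a ≡ c b × c b ≡ c d

_^ℤ_ : (b : ℕ) → .{{ℕ.NonZero b}} → ℤ → ℚ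
(b ^ℤ (+ n)) = (+ (b ℕ.^ n)) / 1
_^ℤ_ b {{nz}} -[1+ n ] = _/_ (+ 1) (b ℕ.^ suc n) {{m^n≢0 b (suc n)}}

pow235 : ℤ → ℤ → ℤ → ℚ
pow235 n m p = (2 ^ℤ n) * (3 ^ℤ m) * (5 ^ℤ p)

-- The degenerate solutions (3t/4, t, t), (t, 5t/6, t) and (t, t, 10t/9) give t, 3t/4 and 5t/6
-- three different colours; hence c(5t/8) = c(t), and similarly c(27t/40) = c(t).  Modulo these
-- invariances a point 2^n 3^m 5^p z reduces to some 2^a 3^r with 0 ≤ r < 3, so near z only
-- finitely many colours are unknown.  For three finite families of solutions an exhaustive
-- search over these colours shows that c(2z) = c(z) forces c(4z) = c(2z), c(z/2) = c(z) and
-- c(3z/2) = c(3z/4).  Hence doubling preserves colours on the whole orbit of x, the colour of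
-- 2^n 3^m 5^p x is that of 3^m x, and m ↦ c(3^m x) has period 3 (27 = 27/40 · 5/8 · 2⁶) and
-- differs at m, m + 1 and m + 2 by the solutions (3t/4, t, t) and (9t/10, 9t/10, t).

module Submission where

open import Defs
open import Data.Integer using (ℤ; +_; _-_)
open import Data.Integer.Divisibility using (_∣_)
open import Data.Rational using (ℚ; 0ℚ; _*_; _/_)
open import Function.Bundles using (_⇔_; mk⇔; Equivalence)
open import Relation.Binary.PropositionalEquality using (_≡_; _≢_)
open import Relation.Nullary using (¬_)

open import Algebra.Bundles using (CommutativeMonoid)
open import Data.Bool using (Bool; true; false; not; _∧_; T)
open import Data.Bool.ListAction using (all; any)
open import Data.Bool.Properties using (T-∧)
open import Data.Empty using (⊥-elim)
open import Data.Fin using (Fin)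
import Data.Fin.Properties as Fin
open import Data.Integer as ℤ using (-[1+_])
open import Data.Integer.DivMod using (_%ℕ_; _/ℕ_; n%ℕd<d; a≡a%ℕn+[a/ℕn]*n)
import Data.Integer.Divisibility.Signed as Signed
import Data.Integer.Properties as ℤ
open import Data.Integer.Tactic.RingSolver using (solve-∀)
open import Data.List using (List; []; _∷_; map; _++_; allFin; deduplicate; concatMap)
open import Data.List.Membership.Propositional.Properties using (∈-allFin)
open import Data.List.Relation.Unary.All as All using (All; []; _∷_)
open import Data.List.Relation.Unary.All.Properties using (all⁻; ++⁺; map⁺)
import Data.List.Relation.Unary.Any as Any
open import Data.List.Relation.Unary.Any.Properties using (any⁺)
open import Data.Maybe using (Maybe; just; nothing)
open import Data.Nat as ℕ using (ℕ; zero; suc)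
import Data.Nat.Properties as ℕ
open import Data.Nat.Tactic.RingSolver renaming (solve-∀ to ℕ-solve-∀)
open import Data.Product using (_×_; _,_; ∃; proj₁; proj₂)
open import Data.Product.Properties using (≡-dec)
open import Data.Rational as ℚ using (1ℚ; toℚᵘ; fromℚᵘ)
import Data.Rational.Properties as ℚ
import Data.Rational.Unnormalised as ℚᵘ
import Data.Rational.Unnormalised.Properties as ℚᵘ
open import Data.Sum using (_⊎_; inj₁; inj₂)
open import Function using (_∘_)
open import Relation.Binary.Definitions using (DecidableEquality)
open import Relation.Binary.PropositionalEquality
  using (refl; sym; trans; cong; cong₂; subst; module ≡-Reasoning)
open import Relation.Nullary using (Dec; yes; no; ¬?)
open import Relation.Nullary.Decidable using (⌊_⌋; True; toWitness)

open import Algebra.Properties.CommutativeSemigroup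
  (CommutativeMonoid.commutativeSemigroup ℚ.*-1-commutativeMonoid) using (interchange; x∙yz≈y∙xz)

-- Induction on ℤ and functions of period 3

ℤ-induction : ∀ {ℓ} (P : ℤ → Set ℓ) → P (+ 0) →
              (∀ i → P i → P (ℤ.suc i)) → (∀ i → P (ℤ.suc i) → P i) → ∀ i → P i
ℤ-induction P P0 up down (+ zero)      = P0
ℤ-induction P P0 up down (+ suc n)     = up (+ n) (ℤ-induction P P0 up down (+ n))
ℤ-induction P P0 up down -[1+ zero ]   = down -[1+ 0 ] P0
ℤ-induction P P0 up down -[1+ suc n ]  = down -[1+ suc n ] (ℤ-induction P P0 up down -[1+ n ])

residue-mod-3 : ∀ d → ∃ λ q → d ≡ q ℤ.* + 3 ⊎ d ≡ + 1 ℤ.+ q ℤ.* + 3 ⊎ d ≡ + 2 ℤ.+ q ℤ.* + 3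
residue-mod-3 d with d %ℕ 3 | n%ℕd<d d 3 | a≡a%ℕn+[a/ℕn]*n d 3
... | 0 | _ | eq = d /ℕ 3 , inj₁ (trans eq (ℤ.+-identityˡ _))
... | 1 | _ | eq = d /ℕ 3 , inj₂ (inj₁ eq)
... | 2 | _ | eq = d /ℕ 3 , inj₂ (inj₂ eq)
... | suc (suc (suc _)) | ℕ.s≤s (ℕ.s≤s (ℕ.s≤s ())) | _

module _ {a} {A : Set a} (f : ℤ → A)
         (period : ∀ m → f (+ 3 ℤ.+ m) ≡ f m)
         (shift₁ : ∀ m → f (+ 1 ℤ.+ m) ≢ f m)
         (shift₂ : ∀ m → f (+ 2 ℤ.+ m) ≢ f m) where

  period-multiple : ∀ q m → f (q ℤ.* + 3 ℤ.+ m) ≡ f m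
  period-multiple = ℤ-induction (λ q → ∀ m → f (q ℤ.* + 3 ℤ.+ m) ≡ f m)
    (λ m → cong f (ℤ.+-identityˡ m))
    (λ q ih m → trans (cong f (step q m)) (trans (period _) (ih m)))
    (λ q ih m → trans (sym (period _)) (trans (cong f (sym (step q m))) (ih m)))
    where
    step : ∀ q m → (+ 1 ℤ.+ q) ℤ.* + 3 ℤ.+ m ≡ + 3 ℤ.+ (q ℤ.* + 3 ℤ.+ m)
    step = solve-∀

  f≡f⇔3∣- : ∀ m₁ m₂ → f m₁ ≡ f m₂ ⇔ + 3 ∣ (m₁ - m₂)
  f≡f⇔3∣- m₁ m₂ = mk⇔ to from
    where
    open ≡-Reasoning
    rearrange : ∀ m₁ m₂ r q → m₁ - m₂ ≡ r ℤ.+ q ℤ.* + 3 → m₁ ≡ q ℤ.* + 3 ℤ.+ (r ℤ.+ m₂)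
    rearrange m₁ m₂ r q eq = begin
      m₁                          ≡⟨ split m₁ m₂ ⟩
      (m₁ - m₂) ℤ.+ m₂            ≡⟨ cong (ℤ._+ m₂) eq ⟩
      r ℤ.+ q ℤ.* + 3 ℤ.+ m₂      ≡⟨ swap r q m₂ ⟩
      q ℤ.* + 3 ℤ.+ (r ℤ.+ m₂)    ∎
      where
      split : ∀ m₁ m₂ → m₁ ≡ (m₁ - m₂) ℤ.+ m₂
      split = solve-∀
      swap : ∀ r q m → r ℤ.+ q ℤ.* + 3 ℤ.+ m ≡ q ℤ.* + 3 ℤ.+ (r ℤ.+ m)
      swap = solve-∀
    to : f m₁ ≡ f m₂ → + 3 ∣ (m₁ - m₂)
    to eq with residue-mod-3 (m₁ - m₂)
    ... | q , inj₁ d≡ = Signed.∣⇒∣ᵤ (Signed.divides q d≡)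
    ... | q , inj₂ (inj₁ d≡) = ⊥-elim (shift₁ m₂ (begin
      f (+ 1 ℤ.+ m₂)                  ≡⟨ period-multiple q _ ⟨
      f (q ℤ.* + 3 ℤ.+ (+ 1 ℤ.+ m₂))  ≡⟨ cong f (rearrange m₁ m₂ (+ 1) q d≡) ⟨
      f m₁                            ≡⟨ eq ⟩
      f m₂                            ∎))
    ... | q , inj₂ (inj₂ d≡) = ⊥-elim (shift₂ m₂ (begin
      f (+ 2 ℤ.+ m₂)                  ≡⟨ period-multiple q _ ⟨
      f (q ℤ.* + 3 ℤ.+ (+ 2 ℤ.+ m₂))  ≡⟨ cong f (rearrange m₁ m₂ (+ 2) q d≡) ⟨
      f m₁                            ≡⟨ eq ⟩
      f m₂                            ∎))
    from : + 3 ∣ (m₁ - m₂) → f m₁ ≡ f m₂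
    from 3∣d with Signed.∣ᵤ⇒∣ {+ 3} 3∣d
    ... | Signed.divides q d≡ = begin
      f m₁                            ≡⟨ cong f (rearrange m₁ m₂ (+ 0) q (trans d≡ (sym (ℤ.+-identityˡ _)))) ⟩
      f (q ℤ.* + 3 ℤ.+ (+ 0 ℤ.+ m₂))  ≡⟨ period-multiple q _ ⟩
      f (+ 0 ℤ.+ m₂)                  ≡⟨ cong f (ℤ.+-identityˡ m₂) ⟩
      f m₂                            ∎

-- Integer powers and exponent vectors

fraction-≡ : ∀ a d m n .{{_ : ℕ.NonZero m}} .{{_ : ℕ.NonZero n}} →
             a ℕ.* n ≡ d ℕ.* m → + a / m ≡ + d / n
fraction-≡ a d (suc m) (suc n) eq = ℚ.fromℚᵘ-cong {ℚᵘ.mkℚᵘ (+ a) m} {ℚᵘ.mkℚᵘ (+ d) n}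
  (ℚᵘ.*≡* (trans (sym (ℤ.pos-* a (suc n))) (trans (cong +_ eq) (ℤ.pos-* d (suc m)))))

fraction-* : ∀ a d m n .{{_ : ℕ.NonZero m}} .{{_ : ℕ.NonZero n}} →
             (+ a / m) * (+ d / n) ≡ _/_ (+ (a ℕ.* d)) (m ℕ.* n) {{ℕ.m*n≢0 m n}}
fraction-* a d (suc m) (suc n) = ℚ.toℚᵘ-injective (begin
  toℚᵘ (fromℚᵘ A * fromℚᵘ B)            ≈⟨ ℚ.toℚᵘ-homo-* (fromℚᵘ A) (fromℚᵘ B) ⟩
  toℚᵘ (fromℚᵘ A) ℚᵘ.* toℚᵘ (fromℚᵘ B)  ≈⟨ ℚᵘ.*-cong (ℚ.toℚᵘ-fromℚᵘ A) (ℚ.toℚᵘ-fromℚᵘ B) ⟩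
  A ℚᵘ.* B                              ≈⟨ ℚᵘ.*≡* (cong (ℤ._* ℚᵘ.↧ C) (sym (ℤ.pos-* a d))) ⟩
  C                                     ≈⟨ ℚᵘ.≃-sym (ℚ.toℚᵘ-fromℚᵘ C) ⟩
  toℚᵘ (fromℚᵘ C)                       ∎)
  where
  open ℚᵘ.≃-Reasoning
  A = ℚᵘ.mkℚᵘ (+ a) m
  B = ℚᵘ.mkℚᵘ (+ d) n
  C = ℚᵘ.mkℚᵘ (+ (a ℕ.* d)) (ℕ.pred (suc m ℕ.* suc n))

^ℤ-suc : ∀ b .{{_ : ℕ.NonZero b}} i → b ^ℤ ℤ.suc i ≡ (+ b / 1) * b ^ℤ i
^ℤ-suc b (+ n)          = sym (fraction-* b (b ℕ.^ n) 1 1)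
^ℤ-suc b -[1+ zero ]    =
  sym (trans (fraction-* b 1 1 (b ℕ.^ 1)) (fraction-≡ (b ℕ.* 1) 1 (1 ℕ.* b ℕ.^ 1) 1 (cross b)))
  where
  instance
    _ = ℕ.m^n≢0 b 1
    _ = ℕ.m*n≢0 1 (b ℕ.^ 1)
  cross : ∀ b → b ℕ.* 1 ℕ.* 1 ≡ 1 ℕ.* (1 ℕ.* (b ℕ.* 1))
  cross = ℕ-solve-∀
^ℤ-suc b -[1+ suc n ]   = sym (trans (fraction-* b 1 1 (b ℕ.^ suc (suc n)))
  (fraction-≡ (b ℕ.* 1) 1 (1 ℕ.* b ℕ.^ suc (suc n)) (b ℕ.^ suc n) (cross b (b ℕ.^ suc n))))
  where
  instance
    _ = ℕ.m^n≢0 b (suc n)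
    _ = ℕ.m^n≢0 b (suc (suc n))
    _ = ℕ.m*n≢0 1 (b ℕ.^ suc (suc n))
  cross : ∀ b k → b ℕ.* 1 ℕ.* k ≡ 1 ℕ.* (1 ℕ.* (b ℕ.* k))
  cross = ℕ-solve-∀

^ℤ-+ : ∀ b .{{_ : ℕ.NonZero b}} i j → b ^ℤ (i ℤ.+ j) ≡ b ^ℤ i * b ^ℤ j
^ℤ-+ b i j = ℤ-induction (λ j → ∀ i → b ^ℤ (i ℤ.+ j) ≡ b ^ℤ i * b ^ℤ j)
  (λ i → trans (cong (b ^ℤ_) (ℤ.+-identityʳ i)) (sym (ℚ.*-identityʳ (b ^ℤ i))))
  up down j i
  where
  open ≡-Reasoning
  B = + b / 1
  up : ∀ j → (∀ i → b ^ℤ (i ℤ.+ j) ≡ b ^ℤ i * b ^ℤ j) →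
       ∀ i → b ^ℤ (i ℤ.+ ℤ.suc j) ≡ b ^ℤ i * b ^ℤ ℤ.suc j
  up j ih i = begin
    b ^ℤ (i ℤ.+ ℤ.suc j)     ≡⟨ cong (b ^ℤ_) (shift i j) ⟩
    b ^ℤ ℤ.suc (i ℤ.+ j)     ≡⟨ ^ℤ-suc b (i ℤ.+ j) ⟩
    B * b ^ℤ (i ℤ.+ j)       ≡⟨ cong (B *_) (ih i) ⟩
    B * (b ^ℤ i * b ^ℤ j)    ≡⟨ x∙yz≈y∙xz B (b ^ℤ i) (b ^ℤ j) ⟩
    b ^ℤ i * (B * b ^ℤ j)    ≡⟨ cong (b ^ℤ i *_) (sym (^ℤ-suc b j)) ⟩
    b ^ℤ i * b ^ℤ ℤ.suc j    ∎
    where shift : ∀ i j → i ℤ.+ (+ 1 ℤ.+ j) ≡ + 1 ℤ.+ (i ℤ.+ j)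
          shift = solve-∀
  down : ∀ j → (∀ i → b ^ℤ (i ℤ.+ ℤ.suc j) ≡ b ^ℤ i * b ^ℤ ℤ.suc j) →
         ∀ i → b ^ℤ (i ℤ.+ j) ≡ b ^ℤ i * b ^ℤ j
  down j ih i = begin
    b ^ℤ (i ℤ.+ j)                  ≡⟨ cong (b ^ℤ_) (shift i j) ⟩
    b ^ℤ (ℤ.pred i ℤ.+ ℤ.suc j)     ≡⟨ ih (ℤ.pred i) ⟩
    b ^ℤ ℤ.pred i * b ^ℤ ℤ.suc j    ≡⟨ cong (b ^ℤ ℤ.pred i *_) (^ℤ-suc b j) ⟩
    b ^ℤ ℤ.pred i * (B * b ^ℤ j)    ≡⟨ x∙yz≈y∙xz (b ^ℤ ℤ.pred i) B (b ^ℤ j) ⟩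
    B * (b ^ℤ ℤ.pred i * b ^ℤ j)    ≡⟨ ℚ.*-assoc B (b ^ℤ ℤ.pred i) (b ^ℤ j) ⟨
    B * b ^ℤ ℤ.pred i * b ^ℤ j      ≡⟨ cong (_* b ^ℤ j) (^ℤ-suc b (ℤ.pred i)) ⟨
    b ^ℤ ℤ.suc (ℤ.pred i) * b ^ℤ j  ≡⟨ cong (λ k → b ^ℤ k * b ^ℤ j) (ℤ.suc-pred i) ⟩
    b ^ℤ i * b ^ℤ j                 ∎
    where shift : ∀ i j → i ℤ.+ j ≡ (ℤ.-1ℤ ℤ.+ i) ℤ.+ (+ 1 ℤ.+ j)
          shift = solve-∀

*-≢0 : ∀ {u z} → u ≢ 0ℚ → z ≢ 0ℚ → u * z ≢ 0ℚ
*-≢0 {u} {z} u≢0 z≢0 uz≡0 = z≢0 (begin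
  z                ≡⟨ ℚ.*-identityˡ z ⟨
  1ℚ * z           ≡⟨ cong (_* z) (ℚ.*-inverseˡ u) ⟨
  ℚ.1/ u * u * z   ≡⟨ ℚ.*-assoc (ℚ.1/ u) u z ⟩
  ℚ.1/ u * (u * z) ≡⟨ cong (ℚ.1/ u *_) uz≡0 ⟩
  ℚ.1/ u * 0ℚ      ≡⟨ ℚ.*-zeroʳ (ℚ.1/ u) ⟩
  0ℚ               ∎)
  where
  open ≡-Reasoning
  instance _ = ℚ.≢-nonZero u≢0

Exponent : Set
Exponent = ℤ × ℤ × ℤ

⟦_⟧ : Exponent → ℚ
⟦ n , m , p ⟧ = pow235 n m p

infixl 6 _⊕_
infixr 7 _·_ 2^_

_⊕_ : Exponent → Exponent → Exponent
(n , m , p) ⊕ (n′ , m′ , p′) = n ℤ.+ n′ , m ℤ.+ m′ , p ℤ.+ p′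

_·_ : ℤ → Exponent → Exponent
k · (n , m , p) = k ℤ.* n , k ℤ.* m , k ℤ.* p

2^_ : ℤ → Exponent
2^ k = k , + 0 , + 0

⊖_ : Exponent → Exponent
⊖ (n , m , p) = ℤ.- n , ℤ.- m , ℤ.- p

exponent-≡ : ∀ {n n′ m m′ p p′ : ℤ} → n ≡ n′ → m ≡ m′ → p ≡ p′ →
             (n , m , p) ≡ (n′ , m′ , p′)
exponent-≡ refl refl refl = refl

⊕-comm : ∀ d e → d ⊕ e ≡ e ⊕ d
⊕-comm (n , m , p) (n′ , m′ , p′) = exponent-≡ (ℤ.+-comm n n′) (ℤ.+-comm m m′) (ℤ.+-comm p p′)

⊕-identityˡ : ∀ e → (+ 0 , + 0 , + 0) ⊕ e ≡ e
⊕-identityˡ (n , m , p) = exponent-≡ (ℤ.+-identityˡ n) (ℤ.+-identityˡ m) (ℤ.+-identityˡ p)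

⊕-assoc : ∀ d e f → (d ⊕ e) ⊕ f ≡ d ⊕ (e ⊕ f)
⊕-assoc (n , m , p) (n′ , m′ , p′) (n″ , m″ , p″) =
  exponent-≡ (ℤ.+-assoc n n′ n″) (ℤ.+-assoc m m′ m″) (ℤ.+-assoc p p′ p″)

⊕-inverseʳ : ∀ e → e ⊕ ⊖ e ≡ (+ 0 , + 0 , + 0)
⊕-inverseʳ (n , m , p) = exponent-≡ (ℤ.+-inverseʳ n) (ℤ.+-inverseʳ m) (ℤ.+-inverseʳ p)

⟦⟧-⊕ : ∀ e f → ⟦ e ⊕ f ⟧ ≡ ⟦ e ⟧ * ⟦ f ⟧
⟦⟧-⊕ (n , m , p) (n′ , m′ , p′) = begin
  2 ^ℤ (n ℤ.+ n′) * 3 ^ℤ (m ℤ.+ m′) * 5 ^ℤ (p ℤ.+ p′)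
    ≡⟨ cong₂ _*_ (cong₂ _*_ (^ℤ-+ 2 n n′) (^ℤ-+ 3 m m′)) (^ℤ-+ 5 p p′) ⟩
  (A * A′) * (B * B′) * (C * C′)   ≡⟨ cong (_* (C * C′)) (interchange A A′ B B′) ⟩
  (A * B) * (A′ * B′) * (C * C′)   ≡⟨ interchange (A * B) (A′ * B′) C C′ ⟩
  (A * B * C) * (A′ * B′ * C′)     ∎
  where
  open ≡-Reasoning
  A = 2 ^ℤ n ; A′ = 2 ^ℤ n′ ; B = 3 ^ℤ m ; B′ = 3 ^ℤ m′ ; C = 5 ^ℤ p ; C′ = 5 ^ℤ p′

⟦⟧-≢0 : ∀ e → ⟦ e ⟧ ≢ 0ℚ
⟦⟧-≢0 e ⟦e⟧≡0 = 1≢0 (begin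
  1ℚ                  ≡⟨⟩
  ⟦ + 0 , + 0 , + 0 ⟧  ≡⟨ cong ⟦_⟧ (⊕-inverseʳ e) ⟨
  ⟦ e ⊕ ⊖ e ⟧         ≡⟨ ⟦⟧-⊕ e (⊖ e) ⟩
  ⟦ e ⟧ * ⟦ ⊖ e ⟧     ≡⟨ cong (_* ⟦ ⊖ e ⟧) ⟦e⟧≡0 ⟩
  0ℚ * ⟦ ⊖ e ⟧        ≡⟨ ℚ.*-zeroˡ ⟦ ⊖ e ⟧ ⟩
  0ℚ                  ∎)
  where
  open ≡-Reasoning
  1≢0 : 1ℚ ≢ 0ℚ
  1≢0 ()

-- 2^n 3^m 5^p reduced modulo 5/8 = 2⁻³5 and 27/40 = 2⁻³3³5⁻¹ to the point 2^a 3^r with 0 ≤ r < 3.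
reduce : Exponent → ℤ × ℕ
reduce (n , m , p) = n ℤ.+ p ℤ.* + 3 ℤ.+ (m /ℕ 3) ℤ.* + 6 , m %ℕ 3

canonical : ℤ × ℕ → Exponent
canonical (a , r) = a , + r , + 0

-- Refuting finite systems of colour constraints

T-not⁺ : ∀ {b} → ¬ T b → T (not b)
T-not⁺ {false} _  = _
T-not⁺ {true}  ¬t = ⊥-elim (¬t _)

T-not⁻ : ∀ {b} → T (not b) → ¬ T b
T-not⁻ {false} _ ()
T-not⁻ {true}  ()

-- A backtracking search for 3-colourings; only its completeness is proved, since it is only used to
-- certify that a system of constraints has no solution.
module NotAllEqual {V : Set} (_≟_ : DecidableEquality V) where

  data Constraint : Set where
    notAllEqual : V → V → V → Constraint
    equal       : V → V → Constraint

  Satisfies : (V → Fin 3) → Constraint → Set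
  Satisfies f (notAllEqual u v w) = ¬ (f u ≡ f v × f v ≡ f w)
  Satisfies f (equal u v)         = f u ≡ f v

  variables : List Constraint → List V
  variables = deduplicate _≟_ ∘ concatMap vars
    where
    vars : Constraint → List V
    vars (notAllEqual u v w) = u ∷ v ∷ w ∷ []
    vars (equal u v)         = u ∷ v ∷ []

  Assignment : Set
  Assignment = List (V × Fin 3)

  colourOf : Assignment → V → Maybe (Fin 3)
  colourOf []            v = nothing
  colourOf ((u , a) ∷ ρ) v with u ≟ v
  ... | yes _ = just a
  ... | no  _ = colourOf ρ v

  knownEqual : Maybe (Fin 3) → Maybe (Fin 3) → Bool
  knownEqual (just a) (just b) = ⌊ a Fin.≟ b ⌋
  knownEqual _        _        = false

  knownDifferent : Maybe (Fin 3) → Maybe (Fin 3) → Bool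
  knownDifferent (just a) (just b) = ⌊ ¬? (a Fin.≟ b) ⌋
  knownDifferent _        _        = false

  respects : Assignment → Constraint → Bool
  respects ρ (notAllEqual u v w) =
    not (knownEqual (colourOf ρ u) (colourOf ρ v) ∧ knownEqual (colourOf ρ v) (colourOf ρ w))
  respects ρ (equal u v) = not (knownDifferent (colourOf ρ u) (colourOf ρ v))

  extendable : List Constraint → List V → Assignment → Bool
  extendable cs []       ρ = all (respects ρ) cs
  extendable cs (v ∷ vs) ρ =
    all (respects ρ) cs ∧ any (λ a → extendable cs vs ((v , a) ∷ ρ)) (allFin 3)

  Refuted : List Constraint → Set
  Refuted cs = T (not (extendable cs (variables cs) []))

  module _ (f : V → Fin 3) where

    Agrees : Assignment → Set
    Agrees = All (λ { (v , a) → f v ≡ a })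

    colourOf-sound : ∀ {ρ} → Agrees ρ → ∀ v {a} → colourOf ρ v ≡ just a → f v ≡ a
    colourOf-sound {(u , b) ∷ ρ} (fu≡b ∷ agrees) v eq with u ≟ v
    colourOf-sound (fu≡b ∷ agrees) v refl | yes refl = fu≡b
    ... | no _ = colourOf-sound agrees v eq

    knownEqual-sound : ∀ {ρ} → Agrees ρ → ∀ u v →
                       T (knownEqual (colourOf ρ u) (colourOf ρ v)) → f u ≡ f v
    knownEqual-sound {ρ} agrees u v t with colourOf ρ u in eu | colourOf ρ v in ev
    ... | just a | just b =
      trans (colourOf-sound agrees u eu) (trans (toWitness t) (sym (colourOf-sound agrees v ev)))

    knownDifferent-sound : ∀ {ρ} → Agrees ρ → ∀ u v →
                           T (knownDifferent (colourOf ρ u) (colourOf ρ v)) → f u ≢ f v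
    knownDifferent-sound {ρ} agrees u v t with colourOf ρ u in eu | colourOf ρ v in ev
    ... | just a | just b = λ fu≡fv →
      toWitness t (trans (sym (colourOf-sound agrees u eu)) (trans fu≡fv (colourOf-sound agrees v ev)))

    respects-sound : ∀ {ρ} → Agrees ρ → ∀ k → Satisfies f k → T (respects ρ k)
    respects-sound agrees (notAllEqual u v w) nae = T-not⁺ λ t →
      let t₁ , t₂ = Equivalence.to T-∧ t
      in nae (knownEqual-sound agrees u v t₁ , knownEqual-sound agrees v w t₂)
    respects-sound agrees (equal u v) fu≡fv = T-not⁺ λ t → knownDifferent-sound agrees u v t fu≡fv

    extendable-complete : ∀ {cs} → All (Satisfies f) cs →
                          ∀ vs {ρ} → Agrees ρ → T (extendable cs vs ρ)
    extendable-complete sat [] agrees = all⁻ _ (All.map (respects-sound agrees _) sat)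
    extendable-complete sat (v ∷ vs) agrees = Equivalence.from T-∧
      ( all⁻ _ (All.map (respects-sound agrees _) sat)
      , any⁺ _ (Any.map (λ fv≡a → extendable-complete sat vs (fv≡a ∷ agrees)) (∈-allFin (f v))))

    refuted-unsatisfiable : ∀ cs → Refuted cs → ¬ All (Satisfies f) cs
    refuted-unsatisfiable cs refuted sat = T-not⁻ refuted (extendable-complete sat (variables cs) [])

-- Colourings without monochromatic solutions

solution-scaled : ∀ {u v w} z → IsSolution u v w → IsSolution (u * z) (v * z) (w * z)
solution-scaled {u} {v} {w} z sol = begin
  u * z ℚ.+ + 3 / 2 * (v * z)   ≡⟨ cong (u * z ℚ.+_) (ℚ.*-assoc (+ 3 / 2) v z) ⟨
  u * z ℚ.+ + 3 / 2 * v * z     ≡⟨ ℚ.*-distribʳ-+ z u (+ 3 / 2 * v) ⟨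
  (u ℚ.+ + 3 / 2 * v) * z       ≡⟨ cong (_* z) sol ⟩
  + 9 / 4 * w * z               ≡⟨ ℚ.*-assoc (+ 9 / 4) w z ⟩
  + 9 / 4 * (w * z)             ∎
  where open ≡-Reasoning

Triple : Set
Triple = Exponent × Exponent × Exponent

IsSolution⟦⟧ : Triple → Set
IsSolution⟦⟧ (e₀ , e₁ , e₂) = IsSolution ⟦ e₀ ⟧ ⟦ e₁ ⟧ ⟦ e₂ ⟧

isSolution⟦⟧? : ∀ t → Dec (IsSolution⟦⟧ t)
isSolution⟦⟧? (e₀ , e₁ , e₂) = _ ℚ.≟ _

_≟ᵉ_ : DecidableEquality Exponent
_≟ᵉ_ = ≡-dec ℤ._≟_ (≡-dec ℤ._≟_ ℤ._≟_)

-- Each Triple is a solution (u, v, w) found by a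
-- computer search; it is used scaled by a common nonzero base point.
module Certificates where
  open import Agda.Builtin.FromNat using (fromNat)
  open import Data.Unit using (tt)
  import Data.Integer.Literals as Literals
  instance
    _ = Literals.number
    _ = Literals.negative

  triangle-5/8 : List Triple
  triangle-5/8 =
      ((-2 , 1 , 0) , (0 , 0 , 0) , (0 , 0 , 0))
    ∷ ((-3 , 0 , 1) , (-1 , -1 , 1) , (-1 , -1 , 1))
    ∷ ((0 , 0 , 0) , (-1 , -1 , 1) , (0 , 0 , 0))
    ∷ ((-2 , 1 , 0) , (-3 , 0 , 1) , (-2 , 1 , 0))
    ∷ ((-2 , 1 , 0) , (-2 , 1 , 0) , (-1 , -1 , 1))
    ∷ []

  triangle-27/40 : List Triple
  triangle-27/40 =
      ((-2 , 1 , 0) , (0 , 0 , 0) , (0 , 0 , 0))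
    ∷ ((-1 , 2 , -1) , (-2 , 1 , 0) , (-1 , 2 , -1))
    ∷ ((-1 , 2 , -1) , (-1 , 2 , -1) , (0 , 0 , 0))
    ∷ ((-3 , 3 , -1) , (-3 , 3 , -1) , (-2 , 1 , 0))
    ∷ ((-3 , 3 , -1) , (-1 , 2 , -1) , (-1 , 2 , -1))
    ∷ []


  certificate-2 : List Triple
  certificate-2 =
      ((2 , 0 , 0) , (1 , -1 , 0) , (2 , -2 , 1))
    ∷ ((-2 , 1 , 0) , (-2 , 1 , 0) , (-1 , -1 , 1))
    ∷ ((-2 , 1 , 0) , (-1 , 1 , 0) , (2 , -1 , 0))
    ∷ ((0 , 0 , 0) , (2 , -1 , 0) , (2 , -1 , 0))
    ∷ ((-2 , 3 , -1) , (-1 , 1 , 0) , (3 , 0 , -1))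
    ∷ ((3 , -1 , 0) , (0 , 0 , 0) , (1 , -3 , 2))
    ∷ ((0 , 2 , -1) , (-1 , 1 , 0) , (0 , 2 , -1))
    ∷ ((2 , 0 , 0) , (1 , -1 , 1) , (2 , 0 , 0))
    ∷ ((0 , 1 , 0) , (2 , 0 , 0) , (2 , 0 , 0))
    ∷ ((-2 , 2 , 0) , (0 , 1 , 0) , (0 , 1 , 0))
    ∷ ((-2 , 0 , 1) , (1 , -1 , 0) , (0 , 0 , 0))
    ∷ ((0 , -1 , 0) , (1 , 0 , 0) , (3 , -3 , 1))
    ∷ ((0 , 1 , 0) , (1 , -1 , 0) , (4 , -2 , 0))
    ∷ ((-1 , 0 , 1) , (0 , -1 , 0) , (2 , -1 , 0))
    ∷ ((0 , 0 , 0) , (1 , 0 , 0) , (4 , -2 , 0))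
    ∷ ((1 , 1 , -1) , (-2 , 2 , -1) , (-1 , -1 , 1))
    ∷ ((-1 , 1 , 0) , (-2 , 0 , 0) , (-1 , -1 , 1))
    ∷ ((-3 , 1 , 1) , (-2 , 0 , 0) , (0 , 0 , 0))
    ∷ ((-3 , 2 , 0) , (-2 , 0 , 0) , (1 , -1 , 0))
    ∷ ((-2 , 0 , 0) , (0 , -1 , 0) , (0 , -1 , 0))
    ∷ ((-2 , 0 , 0) , (-1 , 0 , 1) , (4 , -2 , 0))
    ∷ ((-1 , 1 , -1) , (-1 , 0 , 1) , (0 , 2 , -1))
    ∷ ((-1 , 1 , -1) , (0 , 1 , 0) , (5 , -1 , -1))
    ∷ ((0 , -1 , 0) , (-1 , -2 , 1) , (0 , -1 , 0))
    ∷ ((-1 , 1 , -1) , (1 , 0 , -1) , (1 , 0 , -1))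
    ∷ ((0 , -1 , 1) , (3 , -2 , 0) , (2 , -1 , 0))
    ∷ ((-1 , 1 , 0) , (0 , 1 , -1) , (4 , -1 , -1))
    ∷ ((-3 , 2 , 0) , (-1 , 0 , 0) , (-1 , -1 , 1))
    ∷ ((1 , -1 , 0) , (1 , -1 , 0) , (2 , -3 , 1))
    ∷ ((-2 , 0 , 1) , (-1 , 0 , 0) , (3 , -2 , 0))
    ∷ ((1 , 1 , 0) , (0 , 0 , 0) , (1 , -1 , 1))
    ∷ ((-3 , 2 , 0) , (-2 , 1 , 1) , (0 , 1 , 0))
    ∷ ((0 , -1 , 0) , (5 , -2 , 1) , (2 , 1 , 0))
    ∷ ((-1 , 1 , 1) , (1 , 0 , -1) , (1 , 2 , -1))
    ∷ ((-1 , 1 , 1) , (2 , 0 , 0) , (1 , 1 , 0))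
    ∷ []

  certificate-½ : List Triple
  certificate-½ =
      ((-3 , 1 , 0) , (-2 , 0 , 1) , (0 , 0 , 0))
    ∷ ((0 , 1 , -1) , (-1 , 0 , 0) , (0 , 1 , -1))
    ∷ ((-1 , 0 , 0) , (-2 , -1 , 1) , (-1 , 0 , 0))
    ∷ ((-2 , 0 , 1) , (1 , -1 , 0) , (0 , 0 , 0))
    ∷ ((-2 , 2 , -1) , (0 , 1 , -1) , (0 , 1 , -1))
    ∷ []

  certificate-3/4 : List Triple
  certificate-3/4 =
      ((-2 , 3 , -1) , (-1 , 1 , 0) , (3 , 0 , -1))
    ∷ ((-2 , 1 , 0) , (0 , 0 , 0) , (0 , 0 , 0))
    ∷ ((0 , 2 , -1) , (-1 , 1 , 0) , (0 , 2 , -1))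
    ∷ ((1 , 0 , 0) , (0 , -1 , 1) , (1 , 0 , 0))
    ∷ ((-1 , 2 , -1) , (1 , 1 , -1) , (1 , 1 , -1))
    ∷ ((0 , 0 , 0) , (-1 , -1 , 1) , (0 , 0 , 0))
    ∷ ((0 , 1 , 0) , (0 , 0 , 0) , (1 , 0 , 0))
    ∷ ((-1 , 2 , -1) , (0 , 1 , 0) , (2 , 1 , -1))
    ∷ ((0 , 2 , -1) , (0 , 1 , -1) , (1 , 1 , -1))
    ∷ ((0 , 1 , 0) , (1 , -1 , 0) , (4 , -2 , 0))
    ∷ ((-2 , 2 , -1) , (0 , 1 , -1) , (0 , 1 , -1))
    ∷ ((0 , 1 , 0) , (-1 , 0 , 0) , (0 , -1 , 1))
    ∷ ((0 , 1 , -1) , (-1 , 0 , 0) , (0 , 1 , -1))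
    ∷ ((-1 , 0 , 0) , (-2 , -1 , 1) , (-1 , 0 , 0))
    ∷ []

  1ᵉ 2ᵉ ½ᵉ 3ᵉ ⅓ᵉ 27ᵉ : Exponent
  1ᵉ  = 0 , 0 , 0
  2ᵉ  = 1 , 0 , 0
  ½ᵉ  = -1 , 0 , 0
  3ᵉ  = 0 , 1 , 0
  ⅓ᵉ  = 0 , -1 , 0
  27ᵉ = 0 , 3 , 0

  3/4 5/8 8/5 9/10 27/40 40/27 : Exponent
  3/4   = -2 , 1 , 0
  5/8   = -3 , 0 , 1
  8/5   = 3 , 0 , -1
  9/10  = -1 , 2 , -1
  27/40 = -3 , 3 , -1
  40/27 = 3 , -3 , 1

open Certificates

module _ (c : Colouring3) where

  Invariant : Exponent → Set
  Invariant d = ∀ z → c (⟦ d ⟧ * z) ≡ c z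

  invariant-if-≢0 : ∀ d → (∀ {z} → z ≢ 0ℚ → c (⟦ d ⟧ * z) ≡ c (⟦ 1ᵉ ⟧ * z)) → Invariant d
  invariant-if-≢0 d h z with z ℚ.≟ 0ℚ
  ... | yes refl = cong c (ℚ.*-zeroʳ ⟦ d ⟧)
  ... | no z≢0   = trans (h z≢0) (cong c (ℚ.*-identityˡ z))

  translate : ∀ e f z → c (⟦ e ⟧ * (⟦ f ⟧ * z)) ≡ c (⟦ e ⊕ f ⟧ * z)
  translate e f z = cong c (trans (sym (ℚ.*-assoc ⟦ e ⟧ ⟦ f ⟧ z)) (cong (_* z) (sym (⟦⟧-⊕ e f))))

  invariant-multiple : ∀ d → Invariant d → ∀ k → Invariant (k · d)
  invariant-multiple d inv = ℤ-induction (λ k → Invariant (k · d))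
    (λ z → trans (cong (λ e → c (⟦ e ⟧ * z)) (zero-multiple d)) (cong c (ℚ.*-identityˡ z)))
    (λ k ih z → begin
      c (⟦ ℤ.suc k · d ⟧ * z)      ≡⟨ cong (λ e → c (⟦ e ⟧ * z)) (suc-multiple k d) ⟩
      c (⟦ d ⊕ k · d ⟧ * z)        ≡⟨ translate d (k · d) z ⟨
      c (⟦ d ⟧ * (⟦ k · d ⟧ * z))  ≡⟨ inv _ ⟩
      c (⟦ k · d ⟧ * z)            ≡⟨ ih z ⟩
      c z                          ∎)
    (λ k ih z → begin
      c (⟦ k · d ⟧ * z)            ≡⟨ inv _ ⟨
      c (⟦ d ⟧ * (⟦ k · d ⟧ * z))  ≡⟨ translate d (k · d) z ⟩
      c (⟦ d ⊕ k · d ⟧ * z)        ≡⟨ cong (λ e → c (⟦ e ⟧ * z)) (suc-multiple k d) ⟨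
      c (⟦ ℤ.suc k · d ⟧ * z)      ≡⟨ ih z ⟩
      c z                          ∎)
    where
    open ≡-Reasoning
    zero-multiple : ∀ d → + 0 · d ≡ 1ᵉ
    zero-multiple (n , m , p) = exponent-≡ (ℤ.*-zeroˡ n) (ℤ.*-zeroˡ m) (ℤ.*-zeroˡ p)
    suc-multiple : ∀ k d → ℤ.suc k · d ≡ d ⊕ k · d
    suc-multiple k (n , m , p) = exponent-≡ (distrib k n) (distrib k m) (distrib k p)
      where distrib : ∀ k n → (+ 1 ℤ.+ k) ℤ.* n ≡ n ℤ.+ k ℤ.* n
            distrib = solve-∀

  DoublingAt : Exponent → ℚ → Set
  DoublingAt s z = c (⟦ 2ᵉ ⊕ s ⟧ * z) ≡ c (⟦ s ⟧ * z)

  Doubling : ℚ → Set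
  Doubling = DoublingAt 1ᵉ

  module _ (noMono : ¬ MonoSolution c) where

    notMonochromatic : ∀ {u v w z} → IsSolution u v w → u ≢ 0ℚ → v ≢ 0ℚ → w ≢ 0ℚ → z ≢ 0ℚ →
                       ¬ (c (u * z) ≡ c (v * z) × c (v * z) ≡ c (w * z))
    notMonochromatic {u} {v} {w} {z} sol u≢0 v≢0 w≢0 z≢0 (c₀≡c₁ , c₁≡c₂) = noMono
      (u * z , v * z , w * z , *-≢0 u≢0 z≢0 , *-≢0 v≢0 z≢0 , *-≢0 w≢0 z≢0 ,
       solution-scaled {u} {v} {w} z sol , c₀≡c₁ , c₁≡c₂)

    module Consequences {V : Set} (_≟_ : DecidableEquality V) (key : Exponent → V) (f : V → Fin 3)
                        {z} (z≢0 : z ≢ 0ℚ) (c≡f : ∀ e → c (⟦ e ⟧ * z) ≡ f (key e)) where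
      open NotAllEqual _≟_

      constraints : List Triple → List (Exponent × Exponent) → Exponent × Exponent → List Constraint
      constraints sols hyps (s , t) =
        notAllEqual (key s) (key t) (key t) ∷
        map (λ { (u , v) → equal (key u) (key v) }) hyps ++
        map (λ { (e₀ , e₁ , e₂) → notAllEqual (key e₀) (key e₁) (key e₂) }) sols

      consequence : ∀ sols hyps s t → True (All.all? isSolution⟦⟧? sols) →
                    Refuted (constraints sols hyps (s , t)) →
                    All (λ { (u , v) → c (⟦ u ⟧ * z) ≡ c (⟦ v ⟧ * z) }) hyps →
                    c (⟦ s ⟧ * z) ≡ c (⟦ t ⟧ * z)
      consequence sols hyps s t valid refuted hold with f (key s) Fin.≟ f (key t)
      ... | yes fs≡ft = trans (c≡f s) (trans fs≡ft (sym (c≡f t)))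
      ... | no fs≢ft = ⊥-elim (refuted-unsatisfiable f (constraints sols hyps (s , t)) refuted
        ( (λ { (fs≡ft , _) → fs≢ft fs≡ft })
        ∷ ++⁺ (map⁺ (All.map (λ {(u , v)} → hypothesis u v) hold))
              (map⁺ (All.map (λ {(e₀ , e₁ , e₂)} → solution e₀ e₁ e₂) (toWitness valid)))))
        where
        hypothesis : ∀ u v → c (⟦ u ⟧ * z) ≡ c (⟦ v ⟧ * z) → f (key u) ≡ f (key v)
        hypothesis u v cu≡cv = trans (sym (c≡f u)) (trans cu≡cv (c≡f v))
        solution : ∀ e₀ e₁ e₂ → IsSolution⟦⟧ (e₀ , e₁ , e₂) →
                   ¬ (f (key e₀) ≡ f (key e₁) × f (key e₁) ≡ f (key e₂))
        solution e₀ e₁ e₂ sol (f₀≡f₁ , f₁≡f₂) =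
          notMonochromatic sol (⟦⟧-≢0 e₀) (⟦⟧-≢0 e₁) (⟦⟧-≢0 e₂) z≢0
            ( trans (c≡f e₀) (trans f₀≡f₁ (sym (c≡f e₁)))
            , trans (c≡f e₁) (trans f₁≡f₂ (sym (c≡f e₂))))

    module Exact {z} (z≢0 : z ≢ 0ℚ) =
      Consequences _≟ᵉ_ (λ e → e) (λ e → c (⟦ e ⟧ * z)) z≢0 (λ _ → refl)

    invariant-5/8 : Invariant 5/8
    invariant-5/8 = invariant-if-≢0 5/8 λ z≢0 →
      Exact.consequence z≢0 triangle-5/8 [] 5/8 1ᵉ _ _ []

    invariant-27/40 : Invariant 27/40
    invariant-27/40 = invariant-if-≢0 27/40 λ z≢0 →
      Exact.consequence z≢0 triangle-27/40 [] 27/40 1ᵉ _ _ []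

    invariant-8/5 : Invariant 8/5
    invariant-8/5 = invariant-multiple 5/8 invariant-5/8 ℤ.-1ℤ

    invariant-40/27 : Invariant 40/27
    invariant-40/27 = invariant-multiple 27/40 invariant-27/40 ℤ.-1ℤ

    reduce-sound : ∀ e z → c (⟦ e ⟧ * z) ≡ c (⟦ canonical (reduce e) ⟧ * z)
    reduce-sound e@(n , m , p) z = begin
      c (⟦ e ⟧ * z)                                ≡⟨ cong (λ e → c (⟦ e ⟧ * z)) decompose ⟩
      c (⟦ q · 27/40 ⊕ (s · 5/8 ⊕ can) ⟧ * z)      ≡⟨ translate (q · 27/40) (s · 5/8 ⊕ can) z ⟨
      c (⟦ q · 27/40 ⟧ * (⟦ s · 5/8 ⊕ can ⟧ * z))  ≡⟨ invariant-multiple 27/40 invariant-27/40 q _ ⟩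
      c (⟦ s · 5/8 ⊕ can ⟧ * z)                    ≡⟨ translate (s · 5/8) can z ⟨
      c (⟦ s · 5/8 ⟧ * (⟦ can ⟧ * z))              ≡⟨ invariant-multiple 5/8 invariant-5/8 s _ ⟩
      c (⟦ can ⟧ * z)                              ∎
      where
      open ≡-Reasoning
      q = m /ℕ 3
      r = m %ℕ 3
      s = p ℤ.+ q
      can = canonical (reduce e)
      first : ∀ n p q →
              n ≡ q ℤ.* ℤ.- + 3 ℤ.+ ((p ℤ.+ q) ℤ.* ℤ.- + 3 ℤ.+ (n ℤ.+ p ℤ.* + 3 ℤ.+ q ℤ.* + 6))
      first = solve-∀
      second : ∀ p q r → r ℤ.+ q ℤ.* + 3 ≡ q ℤ.* + 3 ℤ.+ ((p ℤ.+ q) ℤ.* + 0 ℤ.+ r)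
      second = solve-∀
      third : ∀ p q → p ≡ q ℤ.* ℤ.- + 1 ℤ.+ ((p ℤ.+ q) ℤ.* + 1 ℤ.+ + 0)
      third = solve-∀
      decompose : e ≡ q · 27/40 ⊕ (s · 5/8 ⊕ can)
      decompose = exponent-≡ (first n p q) (trans (a≡a%ℕn+[a/ℕn]*n m 3) (second p q (+ r))) (third p q)

    module Reduced {z} (z≢0 : z ≢ 0ℚ) =
      Consequences (≡-dec ℤ._≟_ ℕ._≟_) reduce (λ k → c (⟦ canonical k ⟧ * z)) z≢0
                   (λ e → reduce-sound e z)

    doubling-spreads-2 : ∀ {z} → z ≢ 0ℚ → Doubling z → DoublingAt 2ᵉ z
    doubling-spreads-2 z≢0 d =
      Reduced.consequence z≢0 certificate-2 ((2ᵉ , 1ᵉ) ∷ []) (2ᵉ ⊕ 2ᵉ) 2ᵉ _ _ (d ∷ [])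

    doubling-spreads-½ : ∀ {z} → z ≢ 0ℚ → Doubling z → DoublingAt ½ᵉ z
    doubling-spreads-½ z≢0 d =
      Reduced.consequence z≢0 certificate-½ ((2ᵉ , 1ᵉ) ∷ []) (2ᵉ ⊕ ½ᵉ) ½ᵉ _ _ (d ∷ [])

    doubling-spreads-3/4 : ∀ {z} → z ≢ 0ℚ → Doubling z → DoublingAt 3/4 z
    doubling-spreads-3/4 z≢0 d =
      Reduced.consequence z≢0 certificate-3/4 ((2ᵉ , 1ᵉ) ∷ []) (2ᵉ ⊕ 3/4) 3/4 _ _ (d ∷ [])

    module Orbit {x} (x≢0 : x ≢ 0ℚ) (doubles₀ : Doubling (⟦ 1ᵉ ⟧ * x)) where

      κ : Exponent → Fin 3
      κ e = c (⟦ e ⟧ * x)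

      Doubles : Exponent → Set
      Doubles e = Doubling (⟦ e ⟧ * x)

      Closed Preserving : Exponent → Set
      Closed s     = ∀ e → Doubles e → Doubles (s ⊕ e)
      Preserving s = ∀ e → Doubles e → κ (s ⊕ e) ≡ κ e

      point-≢0 : ∀ e → ⟦ e ⟧ * x ≢ 0ℚ
      point-≢0 e = *-≢0 (⟦⟧-≢0 e) x≢0

      κ-⊕ : ∀ d e → c (⟦ d ⟧ * (⟦ e ⟧ * x)) ≡ κ (d ⊕ e)
      κ-⊕ d e = translate d e x

      κ-1ᵉ : ∀ e → c (⟦ 1ᵉ ⟧ * (⟦ e ⟧ * x)) ≡ κ e
      κ-1ᵉ e = cong c (ℚ.*-identityˡ (⟦ e ⟧ * x))

      doubles-⊕ : ∀ s e → DoublingAt s (⟦ e ⟧ * x) → Doubles (s ⊕ e)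
      doubles-⊕ s e d = begin
        c (⟦ 2ᵉ ⟧ * (⟦ s ⊕ e ⟧ * x))     ≡⟨ κ-⊕ 2ᵉ (s ⊕ e) ⟩
        κ (2ᵉ ⊕ (s ⊕ e))                 ≡⟨ cong κ (⊕-assoc 2ᵉ s e) ⟨
        κ ((2ᵉ ⊕ s) ⊕ e)                 ≡⟨ κ-⊕ (2ᵉ ⊕ s) e ⟨
        c (⟦ 2ᵉ ⊕ s ⟧ * (⟦ e ⟧ * x))     ≡⟨ d ⟩
        c (⟦ s ⟧ * (⟦ e ⟧ * x))          ≡⟨ κ-⊕ s e ⟩
        κ (s ⊕ e)                        ≡⟨ κ-1ᵉ (s ⊕ e) ⟨
        c (⟦ 1ᵉ ⟧ * (⟦ s ⊕ e ⟧ * x))     ∎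
        where open ≡-Reasoning

      closed-2 : Closed 2ᵉ
      closed-2 e g = doubles-⊕ 2ᵉ e (doubling-spreads-2 (point-≢0 e) g)

      closed-½ : Closed ½ᵉ
      closed-½ e g = doubles-⊕ ½ᵉ e (doubling-spreads-½ (point-≢0 e) g)

      closed-3/4 : Closed 3/4
      closed-3/4 e g = doubles-⊕ 3/4 e (doubling-spreads-3/4 (point-≢0 e) g)

      closed-invariant : ∀ d → Invariant d → Closed d
      closed-invariant d inv e g = doubles-⊕ d e (begin
        c (⟦ 2ᵉ ⊕ d ⟧ * z)        ≡⟨ cong (λ f → c (⟦ f ⟧ * z)) (⊕-comm 2ᵉ d) ⟩
        c (⟦ d ⊕ 2ᵉ ⟧ * z)        ≡⟨ translate d 2ᵉ z ⟨
        c (⟦ d ⟧ * (⟦ 2ᵉ ⟧ * z))  ≡⟨ inv _ ⟩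
        c (⟦ 2ᵉ ⟧ * z)            ≡⟨ g ⟩
        c (⟦ 1ᵉ ⟧ * z)            ≡⟨ cong c (ℚ.*-identityˡ z) ⟩
        c z                       ≡⟨ inv z ⟨
        c (⟦ d ⟧ * z)             ∎)
        where
        open ≡-Reasoning
        z = ⟦ e ⟧ * x

      closed-⊕ : ∀ s t → Closed s → Closed t → Closed (s ⊕ t)
      closed-⊕ s t closed-s closed-t e g =
        subst Doubles (sym (⊕-assoc s t e)) (closed-s (t ⊕ e) (closed-t e g))

      preserving-2 : Preserving 2ᵉ
      preserving-2 e g = trans (sym (κ-⊕ 2ᵉ e)) (trans g (κ-1ᵉ e))

      preserving-½ : Preserving ½ᵉ
      preserving-½ e g =
        trans (sym (κ-⊕ ½ᵉ e)) (trans (sym (doubling-spreads-½ (point-≢0 e) g)) (κ-1ᵉ e))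

      preserving-invariant : ∀ d → Invariant d → Preserving d
      preserving-invariant d inv e _ = trans (sym (κ-⊕ d e)) (inv _)

      preserving-⊕ : ∀ s t → Closed t → Preserving s → Preserving t → Preserving (s ⊕ t)
      preserving-⊕ s t closed-t preserving-s preserving-t e g =
        trans (cong κ (⊕-assoc s t e)) (trans (preserving-s (t ⊕ e) (closed-t e g)) (preserving-t e g))

      Neutral : Exponent → Set
      Neutral s = Closed s × Preserving s

      neutral-⊕ : ∀ s t → Neutral s → Neutral t → Neutral (s ⊕ t)
      neutral-⊕ s t (closed-s , preserving-s) (closed-t , preserving-t) =
        closed-⊕ s t closed-s closed-t , preserving-⊕ s t closed-t preserving-s preserving-t

      neutral-invariant : ∀ d → Invariant d → Neutral d
      neutral-invariant d inv = closed-invariant d inv , preserving-invariant d inv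

      neutral-power-of-2 : ∀ k → Neutral (2^ k)
      neutral-power-of-2 (+ zero)      = (λ e → subst Doubles (sym (⊕-identityˡ e)))
                                       , (λ e _ → cong κ (⊕-identityˡ e))
      neutral-power-of-2 (+ suc n)     =
        neutral-⊕ 2ᵉ (2^ + n) (closed-2 , preserving-2) (neutral-power-of-2 (+ n))
      neutral-power-of-2 -[1+ zero ]   = closed-½ , preserving-½
      neutral-power-of-2 -[1+ suc n ]  =
        neutral-⊕ ½ᵉ (2^ -[1+ n ]) (closed-½ , preserving-½) (neutral-power-of-2 -[1+ n ])

      closed-3 : Closed 3ᵉ
      closed-3 = closed-⊕ 2ᵉ (2ᵉ ⊕ 3/4) closed-2 (closed-⊕ 2ᵉ 3/4 closed-2 closed-3/4)

      closed-⅓ : Closed ⅓ᵉ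
      closed-⅓ =
        closed-⊕ 40/27 (8/5 ⊕ (½ᵉ ⊕ (½ᵉ ⊕ (3/4 ⊕ 3/4)))) (closed-invariant 40/27 invariant-40/27)
        (closed-⊕ 8/5 (½ᵉ ⊕ (½ᵉ ⊕ (3/4 ⊕ 3/4))) (closed-invariant 8/5 invariant-8/5)
        (closed-⊕ ½ᵉ (½ᵉ ⊕ (3/4 ⊕ 3/4)) closed-½
        (closed-⊕ ½ᵉ (3/4 ⊕ 3/4) closed-½
        (closed-⊕ 3/4 3/4 closed-3/4 closed-3/4))))

      doubles-power-of-3 : ∀ m → Doubles (+ 0 , m , + 0)
      doubles-power-of-3 (+ zero)      = doubles₀
      doubles-power-of-3 (+ suc n)     = closed-3 (+ 0 , + n , + 0) (doubles-power-of-3 (+ n))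
      doubles-power-of-3 -[1+ zero ]   = closed-⅓ 1ᵉ doubles₀
      doubles-power-of-3 -[1+ suc n ]  = closed-⅓ (+ 0 , -[1+ n ] , + 0) (doubles-power-of-3 -[1+ n ])

      κ-3/4-≢ : ∀ e → κ (3/4 ⊕ e) ≢ κ e
      κ-3/4-≢ e eq = notMonochromatic {⟦ 3/4 ⟧} {⟦ 1ᵉ ⟧} {⟦ 1ᵉ ⟧} refl
        (⟦⟧-≢0 3/4) (⟦⟧-≢0 1ᵉ) (⟦⟧-≢0 1ᵉ) (point-≢0 e)
        (trans (κ-⊕ 3/4 e) (trans eq (sym (κ-1ᵉ e))) , refl)

      κ-9/10-≢ : ∀ e → κ (9/10 ⊕ e) ≢ κ e
      κ-9/10-≢ e eq = notMonochromatic {⟦ 9/10 ⟧} {⟦ 9/10 ⟧} {⟦ 1ᵉ ⟧} refl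
        (⟦⟧-≢0 9/10) (⟦⟧-≢0 9/10) (⟦⟧-≢0 1ᵉ) (point-≢0 e)
        (refl , trans (κ-⊕ 9/10 e) (trans eq (sym (κ-1ᵉ e))))

      colour : ℤ → Fin 3
      colour m = κ (+ 0 , m , + 0)

      κ≡colour : ∀ n m p → κ (n , m , p) ≡ colour m
      κ≡colour n m p = begin
        κ (n , m , p)                   ≡⟨ cong κ decompose ⟩
        κ (p · 5/8 ⊕ (2^ a ⊕ e))        ≡⟨ preserving-invariant (p · 5/8) invariant-5/8ᵖ (2^ a ⊕ e)
                                             (proj₁ (neutral-power-of-2 a) e (doubles-power-of-3 m)) ⟩
        κ (2^ a ⊕ e)                    ≡⟨ proj₂ (neutral-power-of-2 a) e (doubles-power-of-3 m) ⟩
        κ e                             ∎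
        where
        open ≡-Reasoning
        a = n ℤ.+ p ℤ.* + 3
        e = + 0 , m , + 0
        invariant-5/8ᵖ = invariant-multiple 5/8 invariant-5/8 p
        first : ∀ n p → n ≡ p ℤ.* ℤ.- + 3 ℤ.+ (n ℤ.+ p ℤ.* + 3 ℤ.+ + 0)
        first = solve-∀
        second : ∀ p m → m ≡ p ℤ.* + 0 ℤ.+ (+ 0 ℤ.+ m)
        second = solve-∀
        third : ∀ p → p ≡ p ℤ.* + 1 ℤ.+ (+ 0 ℤ.+ + 0)
        third = solve-∀
        decompose : (n , m , p) ≡ p · 5/8 ⊕ (2^ a ⊕ e)
        decompose = exponent-≡ (first n p) (second p m) (third p)

      colour-period : ∀ m → colour (+ 3 ℤ.+ m) ≡ colour m
      colour-period m = proj₂ neutral-27 (+ 0 , m , + 0) (doubles-power-of-3 m)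
        where
        neutral-27 : Neutral 27ᵉ
        neutral-27 = neutral-⊕ 27/40 (5/8 ⊕ 2^ + 6) (neutral-invariant 27/40 invariant-27/40)
          (neutral-⊕ 5/8 (2^ + 6) (neutral-invariant 5/8 invariant-5/8) (neutral-power-of-2 (+ 6)))

      colour-shift₁ : ∀ m → colour (+ 1 ℤ.+ m) ≢ colour m
      colour-shift₁ m eq = κ-3/4-≢ e (begin
        κ (3/4 ⊕ e)                ≡⟨ proj₂ (neutral-power-of-2 (+ 2)) (3/4 ⊕ e) doubles-3/4 ⟨
        κ (2^ + 2 ⊕ (3/4 ⊕ e))     ≡⟨ cong κ (⊕-assoc (2^ + 2) 3/4 e) ⟨
        colour (+ 1 ℤ.+ m)         ≡⟨ eq ⟩
        κ e                        ∎)
        where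
        open ≡-Reasoning
        e = + 0 , m , + 0
        doubles-3/4 = closed-3/4 e (doubles-power-of-3 m)

      colour-shift₂ : ∀ m → colour (+ 2 ℤ.+ m) ≢ colour m
      colour-shift₂ m eq = κ-9/10-≢ (t ⊕ e) (begin
        κ (9/10 ⊕ (t ⊕ e))     ≡⟨ cong κ (⊕-assoc 9/10 t e) ⟨
        colour (+ 2 ℤ.+ m)     ≡⟨ eq ⟩
        κ e                    ≡⟨ proj₂ neutral-t e (doubles-power-of-3 m) ⟨
        κ (t ⊕ e)              ∎)
        where
        open ≡-Reasoning
        e = + 0 , m , + 0
        t = 5/8 ⊕ 2^ + 4
        neutral-t : Neutral t
        neutral-t =
          neutral-⊕ 5/8 (2^ + 4) (neutral-invariant 5/8 invariant-5/8) (neutral-power-of-2 (+ 4))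

      κ≡κ⇔3∣- : ∀ n₁ m₁ p₁ n₂ m₂ p₂ →
                κ (n₁ , m₁ , p₁) ≡ κ (n₂ , m₂ , p₂) ⇔ + 3 ∣ (m₁ - m₂)
      κ≡κ⇔3∣- n₁ m₁ p₁ n₂ m₂ p₂ = mk⇔
        (λ eq → to (trans (sym (κ≡colour n₁ m₁ p₁)) (trans eq (κ≡colour n₂ m₂ p₂))))
        (λ 3∣ → trans (κ≡colour n₁ m₁ p₁) (trans (from 3∣) (sym (κ≡colour n₂ m₂ p₂))))
        where open Equivalence (f≡f⇔3∣- colour colour-period colour-shift₁ colour-shift₂ m₁ m₂)

lemma24 : (c : Colouring3) → ¬ MonoSolution c →
    (x : ℚ) → x ≢ 0ℚ → c (((+ 2) / 1) * x) ≡ c x →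
    (m₁ n₁ p₁ m₂ n₂ p₂ : ℤ) →
    (c (pow235 n₁ m₁ p₁ * x) ≡ c (pow235 n₂ m₂ p₂ * x)) ⇔ ((+ 3) ∣ (m₁ - m₂))
lemma24 c noMono x x≢0 doubles m₁ n₁ p₁ m₂ n₂ p₂ =
  Orbit.κ≡κ⇔3∣- c noMono x≢0 doubles₀ n₁ m₁ p₁ n₂ m₂ p₂
  where
  doubles₀ : Doubling c (⟦ 1ᵉ ⟧ * x)
  doubles₀ = trans (cong (λ w → c (⟦ 2ᵉ ⟧ * w)) (ℚ.*-identityˡ x))
                   (trans doubles (cong c (sym (trans (ℚ.*-identityˡ _) (ℚ.*-identityˡ x)))))
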